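{- Let $G$ be a planar PCC graph, let $v$ be a vertex and let $\sigma$ be a face appearing in the multiset $F(v)$ with multiplicity $2$. Then $7\le|\sigma|\le 11$.
   Context: All graphs are finite, simple, connected, and 2-cell embedded in the sphere; the set of faces includes the outer face. For a face $\sigma$, $|\sigma|$ is the number of edges in its boundary walk, counted with multiplicity. For a vertex $v$, $F(v)$ is the multiset of faces incident to $v$ (one entry per corner at $v$), $K(v)=1-\frac{\deg(v)}{2}+\sum_{\sigma\in F(v)}\frac{1}{|\sigma|}$, and the face vector $f(v)$ is the multiset of sizes of faces in $F(v)$. A prism of order $N$: $2N$ vertices, two faces of size $N$, $N$ faces of size $4$, $f(v)=\{4,4,N\}$ for all $v$. An antiprism of order $N$: $2N$ vertices, two faces of size $N$, $2N$ faces of size $3$, $f(v)=\{3,3,3,N\}$ for all $v$. A planar PCC graph is such a graph with $K(v)>0$ and $\deg(v)\ge3$ for every vertex $v$, which is not a prism or an antiprism. -}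

module Defs where

open import Data.Nat as ℕ using (ℕ; zero; suc; _+_; _*_; _≤_; _<_)
open import Data.Fin as Fin using (Fin; toℕ)
open import Data.Bool using (Bool; true; false; if_then_else_; _∧_)
open import Data.List using (List; []; _∷_; upTo; map; filter; length; _++_; replicate; allFin)
open import Data.Bool.ListAction using (any; all)
open import Data.Bool using (T?)
open import Data.Integer using (+_)
open import Data.Rational as ℚ using (ℚ; 0ℚ; 1ℚ)
open import Data.Product using (∃-syntax; _×_; Σ-syntax)
open import Relation.Binary.PropositionalEquality using (_≡_; _≢_)
open import Relation.Nullary using (¬_; does)
open import Data.List.Relation.Binary.Permutation.Propositional using (_↭_)

-- Planar graphs are represented as combinatorial maps (rotation systems)
-- on the darts Fin n: α is the fixed-point-free involution pairing the
-- two darts of an edge, σ is the rotation at vertices (vertices = σ-orbits),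
-- faces are the orbits of φ = σ ∘ α. Every such map is a 2-cell embedding;
-- it is spherical iff V − E + F = 2 (with E = n / 2).

iter : {A : Set} → (A → A) → ℕ → A → A
iter f zero    x = x
iter f (suc k) x = f (iter f k x)

_==_ : {n : ℕ} → Fin n → Fin n → Bool
a == b = does (a Fin.≟ b)

-- period of x under f : the least k ≥ 1 with f^k x = x (searched in 1..n;
-- for a permutation of Fin n it always exists). Always of the form suc _.
module _ {n : ℕ} (f : Fin n → Fin n) (x : Fin n) where
  search : ℕ → ℕ → ℕ
  search zero    k = k
  search (suc fuel) k = if iter f (suc k) x == x then k else search fuel (suc k)

  period : ℕ
  period = suc (search n 0)

  orbit : List (Fin n)
  orbit = map (λ i → iter f i x) (upTo period)

  inOrbit : Fin n → Bool
  inOrbit y = any (λ z → z == y) orbit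

  isRep : Bool
  isRep = all (λ z → does (toℕ x ℕ.≤? toℕ z)) orbit

record Map (n : ℕ) : Set where
  field
    α    : Fin n → Fin n
    σ    : Fin n → Fin n
    σ⁻   : Fin n → Fin n
    α-invol  : ∀ d → α (α d) ≡ d
    α-nofix  : ∀ d → α d ≢ d
    σσ⁻  : ∀ d → σ (σ⁻ d) ≡ d
    σ⁻σ  : ∀ d → σ⁻ (σ d) ≡ d

  φ : Fin n → Fin n
  φ d = σ (α d)

  SameVertex : Fin n → Fin n → Set
  SameVertex d e = ∃[ k ] iter σ k d ≡ e

  deg : Fin n → ℕ
  deg d = period σ d

  -- |face| : length of the boundary walk (edges counted with multiplicity)
  faceSize : Fin n → ℕ
  faceSize d = period φ d

  numV : ℕ
  numV = length (filter (λ d → T? (isRep σ d)) (allFin n))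

  faceReps : List (Fin n)
  faceReps = filter (λ d → T? (isRep φ d)) (allFin n)

  numF : ℕ
  numF = length faceReps

  faceSizes : List ℕ
  faceSizes = map faceSize faceReps

  -- corners at the vertex of d are the darts σ^i d, i < deg d; the corner
  -- at dart c lies in the face (φ-orbit) of c.
  corners : Fin n → List (Fin n)
  corners d = orbit σ d

  faceVec : Fin n → List ℕ
  faceVec d = map faceSize (corners d)

  mult : Fin n → Fin n → ℕ
  mult d e = length (filter (λ c → T? (inOrbit φ e c)) (corners d))

  recip : Fin n → ℚ
  recip c = (+ 1) ℚ./ faceSize c

  sumℚ : List ℚ → ℚ
  sumℚ []       = 0ℚ
  sumℚ (q ∷ qs) = q ℚ.+ sumℚ qs

  K : Fin n → ℚ
  K d = (1ℚ ℚ.- ((+ deg d) ℚ./ 2)) ℚ.+ sumℚ (map recip (corners d))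

-- connectedness of the underlying graph: monodromy group acts transitively
data Reach {n : ℕ} (M : Map n) : Fin n → Fin n → Set where
  here  : ∀ {d} → Reach M d d
  stepα : ∀ {d e} → Reach M (Map.α M d) e → Reach M d e
  stepσ : ∀ {d e} → Reach M (Map.σ M d) e → Reach M d e

Connected : {n : ℕ} → Map n → Set
Connected M = ∀ d e → Reach M d e

-- simple: no loops, no multiple edges
Simple : {n : ℕ} → Map n → Set
Simple M = (∀ d → ¬ SameVertex d (α d))
         × (∀ d d' → SameVertex d d' → SameVertex (α d) (α d') → d ≡ d')
  where open Map M

-- embedded in the sphere: Euler's formula V − E + F = 2, E = n/2
Spherical : {n : ℕ} → Map n → Set
Spherical {n} M = 2 * numV + 2 * numF ≡ n + 4
  where open Map M

IsPrism : {n : ℕ} → Map n → Set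
IsPrism M = ∃[ N ] (numV ≡ 2 * N)
                 × (faceSizes ↭ (replicate 2 N ++ replicate N 4))
                 × (∀ d → faceVec d ↭ (4 ∷ 4 ∷ N ∷ []))
  where open Map M

IsAntiprism : {n : ℕ} → Map n → Set
IsAntiprism M = ∃[ N ] (numV ≡ 2 * N)
                 × (faceSizes ↭ (replicate 2 N ++ replicate (2 * N) 3))
                 × (∀ d → faceVec d ↭ (3 ∷ 3 ∷ 3 ∷ N ∷ []))
  where open Map M

PlanarPCC : {n : ℕ} → Map n → Set
PlanarPCC M = Connected M × Simple M × Spherical M
            × (∀ d → 0ℚ ℚ.< K d)
            × (∀ d → 3 ≤ deg d)
            × ¬ IsPrism M × ¬ IsAntiprism M
  where open Map M

-- If the face σ passes through v at two distinct corners, these cut its boundary walk into two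
-- closed walks through v. In a simple graph with no vertex of degree < 2 such a walk has length
-- at least 3, so |σ| ≥ 6. If deg v = 3 the two corners are consecutive in the rotation at v, and
-- a face walk from a dart to its rotation successor needs at least 5 steps, so |σ| ≥ 8.
-- Since K(v) = 1 + Σ (1/|τ| − 1/2) over the corners of v and every face has size at least 3,
-- deg v ≥ 4 would give K(v) ≤ 1 + 2(1/6 − 1/2) + 2(1/3 − 1/2) = 0, and |σ| ≥ 12 would give
-- K(v) ≤ 1 + 2(1/12 − 1/2) + (1/3 − 1/2) = 0.

module Submission where

open import Defs
open import Data.Bool using (Bool; true; false; T; not; if_then_else_)
open import Data.Empty using (⊥)
open import Data.Fin as Fin using (Fin; toℕ)
open import Data.List using (List; []; _∷_; length; map; filter; foldr; upTo; applyUpTo)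
open import Data.List.Properties using (length-map; length-upTo; map-upTo)
open import Data.Nat as ℕ using (ℕ; zero; suc)
open import Data.Product using (∃-syntax; _×_; _,_; proj₁; proj₂)
open import Data.Rational using (ℚ)
open import Data.Sum using (_⊎_; inj₁; inj₂)
open import Function using (_∘_; _⇔_; mk⇔)
open import Function.Definitions using (Injective)
open import Relation.Binary.PropositionalEquality
open import Relation.Nullary using (¬_; yes; no)
open import Relation.Nullary.Decidable using (T?; does-⇔)
open import Relation.Nullary.Negation using (contradiction)

==⇒≡ : ∀ {n} {x y : Fin n} → T (x == y) → x ≡ y
==⇒≡ {x = x} {y} x==y with x Fin.≟ y
... | yes x≡y = x≡y

module Cycles {n : ℕ} (f : Fin n → Fin n) where

  open import Data.Nat
  open import Data.Nat.Properties
  open import Data.Fin.Properties using (pigeonhole; toℕ<n)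
  open import Data.List.Membership.Propositional using (find)
  open import Data.List.Membership.Propositional.Properties using (∈-map⁻; ∈-upTo⁻)
  open import Data.List.Relation.Unary.Any.Properties using (any⁻)
  open import Relation.Binary.Definitions using (tri<; tri≈; tri>)

  iter-+ : ∀ a b x → iter f (a + b) x ≡ iter f a (iter f b x)
  iter-+ zero    b x = refl
  iter-+ (suc a) b x = cong f (iter-+ a b x)

  iter-comm : ∀ a b x → iter f a (iter f b x) ≡ iter f b (iter f a x)
  iter-comm a b x = begin
    iter f a (iter f b x) ≡⟨ iter-+ a b x ⟨
    iter f (a + b) x      ≡⟨ cong (λ k → iter f k x) (+-comm a b) ⟩
    iter f (b + a) x      ≡⟨ iter-+ b a x ⟩
    iter f b (iter f a x) ∎
    where open ≡-Reasoning

  _↝_ : Fin n → Fin n → Set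
  x ↝ y = ∃[ k ] iter f k x ≡ y

  ↝-step : ∀ x → x ↝ f x
  ↝-step x = 1 , refl

  ↝-trans : ∀ {x y z} → x ↝ y → y ↝ z → x ↝ z
  ↝-trans {x} (a , refl) (b , refl) = b + a , iter-+ b a x

  inOrbit-sound : ∀ {x y} → T (inOrbit f x y) → ∃[ i ] i < period f x × iter f i x ≡ y
  inOrbit-sound {x} {y} hit with z , z∈orbit , z==y ← find (any⁻ (_== y) (orbit f x) hit)
                            with i , i∈ , refl ← ∈-map⁻ (λ i → iter f i x) z∈orbit
    = i , ∈-upTo⁻ i∈ , ==⇒≡ z==y

  module _ (x : Fin n) where

    search-minimal : ∀ fuel k {i} → k ≤ i → i < search f x fuel k → iter f (suc i) x ≢ x
    search-minimal zero       k k≤i i<k = contradiction k≤i (<⇒≱ i<k)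
    search-minimal (suc fuel) k k≤i i<s with iter f (suc k) x Fin.≟ x | m≤n⇒m<n∨m≡n k≤i
    ... | yes _   | _        = contradiction k≤i (<⇒≱ i<s)
    ... | no fk≢x | inj₂ refl = fk≢x
    ... | no _    | inj₁ k<i  = search-minimal fuel (suc k) k<i i<s

    search-finds : ∀ fuel k {m} → k ≤ m → m < k + fuel → iter f (suc m) x ≡ x →
                   iter f (suc (search f x fuel k)) x ≡ x
    search-finds zero       k k≤m m<k _ = contradiction k≤m (<⇒≱ (subst (_ <_) (+-identityʳ k) m<k))
    search-finds (suc fuel) k {m} k≤m m< fm≡x with iter f (suc k) x Fin.≟ x | m≤n⇒m<n∨m≡n k≤m
    ... | yes fk≡x | _         = fk≡x
    ... | no fk≢x  | inj₂ refl = contradiction fm≡x fk≢x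
    ... | no _     | inj₁ k<m  = search-finds fuel (suc k) k<m (subst (m <_) (+-suc k fuel) m<) fm≡x

    iter-period-minimal : ∀ {m} → 0 < m → m < period f x → iter f m x ≢ x
    iter-period-minimal {suc m} _ (s≤s m<) = search-minimal n 0 z≤n m<

  record Arcs (p : ℕ) (x y : Fin n) : Set where
    field
      len₁ len₂   : ℕ
      len₁+len₂≡p : len₁ + len₂ ≡ p
      iter-len₁   : iter f len₁ x ≡ y
      iter-len₂   : iter f len₂ y ≡ x

  arcs-swap : ∀ {p x y} → Arcs p x y → Arcs p y x
  arcs-swap record { len₁ = a ; len₂ = b ; len₁+len₂≡p = a+b≡p ; iter-len₁ = ea ; iter-len₂ = eb } =
    record { len₁ = b ; len₂ = a ; len₁+len₂≡p = trans (+-comm b a) a+b≡p ; iter-len₁ = eb ; iter-len₂ = ea }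

  arcs₃-adjacent : ∀ {x y} → Arcs 3 x y → x ≢ y → y ≡ f x ⊎ x ≡ f y
  arcs₃-adjacent record { len₁ = 0 ; iter-len₁ = x≡y } x≢y = contradiction x≡y x≢y
  arcs₃-adjacent record { len₁ = 1 ; iter-len₁ = fx≡y } _ = inj₁ (sym fx≡y)
  arcs₃-adjacent record { len₁ = 2 ; len₁+len₂≡p = refl ; iter-len₂ = fy≡x } _ = inj₂ (sym fy≡x)
  arcs₃-adjacent record { len₁ = 3 ; len₁+len₂≡p = refl ; iter-len₂ = y≡x } x≢y = contradiction (sym y≡x) x≢y
  arcs₃-adjacent record { len₁ = suc (suc (suc (suc _))) ; len₁+len₂≡p = () }

  arcs-length : ∀ {p x y a b} (A : Arcs p x y) → a ≤ Arcs.len₁ A → b ≤ Arcs.len₂ A → a + b ≤ p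
  arcs-length A a≤len₁ b≤len₂ = ≤-trans (+-mono-≤ a≤len₁ b≤len₂) (≤-reflexive (Arcs.len₁+len₂≡p A))

  module _ (f-injective : Injective _≡_ _≡_ f) where

    iter-injective : ∀ k {x y} → iter f k x ≡ iter f k y → x ≡ y
    iter-injective zero    eq = eq
    iter-injective (suc k) eq = iter-injective k (f-injective eq)

    -- By pigeonhole two of x, f x, …, fⁿ x coincide, and injectivity turns this into a return
    -- to x within the range scanned by search.
    iter-period : ∀ x → iter f (period f x) x ≡ x
    iter-period x with i , j , i<j , fⁱx≡fʲx ← pigeonhole (n<1+n n) (λ i → iter f (toℕ i) x)
                  with o , i+1+o≡j ← m≤n⇒∃[o]m+o≡n i<j
      = search-finds x n 0 z≤n o<n (sym x≡fᵒ⁺¹x)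
      where
        o<n : o < n
        o<n = ≤-trans (s≤s (m≤n+m o (toℕ i))) (≤-trans (≤-reflexive i+1+o≡j) (≤-pred (toℕ<n j)))
        x≡fᵒ⁺¹x : x ≡ iter f (suc o) x
        x≡fᵒ⁺¹x = iter-injective (toℕ i) (begin
          iter f (toℕ i) x              ≡⟨ fⁱx≡fʲx ⟩
          iter f (toℕ j) x              ≡⟨ cong (λ k → iter f k x) (trans (sym i+1+o≡j) (sym (+-suc (toℕ i) o))) ⟩
          iter f (toℕ i + suc o) x      ≡⟨ iter-+ (toℕ i) (suc o) x ⟩
          iter f (toℕ i) (iter f (suc o) x) ∎)
          where open ≡-Reasoning

    ↝-step⁻ : ∀ x → f x ↝ x
    ↝-step⁻ x = search f x n 0 , trans (sym (iter-comm 1 (search f x n 0) x)) (iter-period x)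

    period-iter : ∀ a x → period f (iter f a x) ≡ period f x
    period-iter a x = cong suc (search-cong n 0)
      where
        y = iter f a x
        returns⇔ : ∀ m → (iter f m y ≡ y) ⇔ (iter f m x ≡ x)
        returns⇔ m = mk⇔
          (λ e → iter-injective a (trans (iter-comm a m x) e))
          (λ e → trans (sym (iter-comm a m x)) (cong (iter f a) e))
        search-cong : ∀ fuel k → search f y fuel k ≡ search f x fuel k
        search-cong zero       k = refl
        search-cong (suc fuel) k = cong₂ (λ b r → if b then k else r)
          (does-⇔ (returns⇔ (suc k)) (iter f (suc k) y Fin.≟ y) (iter f (suc k) x Fin.≟ x))
          (search-cong fuel (suc k))

    iter-≢-below-period : ∀ {a b x} → a < b → b < period f x → iter f a x ≢ iter f b x
    iter-≢-below-period {a} {b} {x} a<b b<p fᵃx≡fᵇx with g , a+1+g≡b ← m≤n⇒∃[o]m+o≡n a<b =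
      iter-period-minimal x (s≤s z≤n) (≤-<-trans (≤-trans (s≤s (m≤n+m g a)) (≤-reflexive a+1+g≡b)) b<p)
        (sym (iter-injective a (begin
          iter f a x                 ≡⟨ fᵃx≡fᵇx ⟩
          iter f b x                 ≡⟨ cong (λ k → iter f k x) (trans (sym a+1+g≡b) (sym (+-suc a g))) ⟩
          iter f (a + suc g) x       ≡⟨ iter-+ a (suc g) x ⟩
          iter f a (iter f (suc g) x) ∎)))
      where open ≡-Reasoning

    arcs-from : ∀ {ℓ x y} → ℓ ≤ period f x → iter f ℓ x ≡ y → Arcs (period f x) x y
    arcs-from {ℓ} {x} ℓ≤p refl = record
      { len₁ = ℓ ; len₂ = period f x ∸ ℓ
      ; len₁+len₂≡p = m+[n∸m]≡n ℓ≤p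
      ; iter-len₁ = refl
      ; iter-len₂ = begin
          iter f (period f x ∸ ℓ) (iter f ℓ x) ≡⟨ iter-+ (period f x ∸ ℓ) ℓ x ⟨
          iter f (period f x ∸ ℓ + ℓ) x        ≡⟨ cong (λ k → iter f k x) (m∸n+n≡m ℓ≤p) ⟩
          iter f (period f x) x                ≡⟨ iter-period x ⟩
          x                                    ∎
      }
      where open ≡-Reasoning

    arcs : ∀ {a b s} → a < b → b < period f s → Arcs (period f s) (iter f a s) (iter f b s)
    arcs {a} {b} {s} a<b b<p = subst (λ p → Arcs p (iter f a s) (iter f b s)) (period-iter a s)
      (arcs-from (subst (b ∸ a ≤_) (sym (period-iter a s)) (≤-trans (m∸n≤m b a) (<⇒≤ b<p)))
        (begin
          iter f (b ∸ a) (iter f a s) ≡⟨ iter-+ (b ∸ a) a s ⟨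
          iter f (b ∸ a + a) s        ≡⟨ cong (λ k → iter f k s) (m∸n+n≡m (<⇒≤ a<b)) ⟩
          iter f b s                  ∎))
      where open ≡-Reasoning

    arcs-inOrbit : ∀ {s x y} → T (inOrbit f s x) → T (inOrbit f s y) → x ≢ y → Arcs (period f s) x y
    arcs-inOrbit hitx hity x≢y with a , a<p , refl ← inOrbit-sound hitx | b , b<p , refl ← inOrbit-sound hity
                                with <-cmp a b
    ... | tri< a<b _ _ = arcs a<b b<p
    ... | tri≈ _ refl _ = contradiction refl x≢y
    ... | tri> _ _ b<a = arcs-swap (arcs b<a a<p)

count : ∀ {A : Set} → (A → Bool) → List A → ℕ
count P xs = length (filter (T? ∘ P) xs)

module _ {A : Set} (P : A → Bool) where

  open import Data.Nat
  open import Data.Nat.Properties using (+-suc)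

  count+count-not : ∀ xs → count P xs + count (not ∘ P) xs ≡ length xs
  count+count-not []       = refl
  count+count-not (x ∷ xs) with P x
  ... | true  = cong suc (count+count-not xs)
  ... | false = trans (+-suc (count P xs) _) (cong suc (count+count-not xs))

  hit : ∀ h m → 1 ≤ count P (applyUpTo h m) → ∃[ i ] i < m × T (P (h i))
  hit h (suc m) c with P (h 0) in eq
  ... | true  = 0 , s≤s z≤n , subst T (sym eq) _
  ... | false with i , i<m , Phi ← hit (h ∘ suc) m c = suc i , s≤s i<m , Phi

  two-hits : ∀ h m → 2 ≤ count P (applyUpTo h m) →
             ∃[ i ] ∃[ j ] i < j × j < m × T (P (h i)) × T (P (h j))
  two-hits h (suc m) c with P (h 0) in eq
  ... | true with j , j<m , Phj ← hit (h ∘ suc) m (s≤s⁻¹ c) =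
    0 , suc j , s≤s z≤n , s≤s j<m , subst T (sym eq) _ , Phj
  ... | false with i , j , i<j , j<m , Phi , Phj ← two-hits (h ∘ suc) m c =
    suc i , suc j , s≤s i<j , s≤s j<m , Phi , Phj

module _ where

  open import Algebra.Bundles using (CommutativeMonoid)
  open import Data.Integer as ℤ using (+_)
  import Data.Integer.Tactic.RingSolver as ℤ-Solver
  open import Data.Nat using (z≤n; s≤s)
  import Data.Nat.Properties as ℕP
  open import Data.Rational using (0ℚ; 1ℚ; ½; _+_; _-_; _/_; _≤_; toℚᵘ; +-0-rawMonoid)
  open import Data.Rational.Properties
  open import Data.Rational.Solver using (module +-*-Solver)
  open import Data.Rational.Unnormalised as ℚᵘ using (mkℚᵘ; *≡*; *≤*)
  import Data.Rational.Unnormalised.Properties as ℚᵘP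
  open import Algebra.Definitions.RawMonoid +-0-rawMonoid using () renaming (_×_ to _×ₙ_)
  open import Algebra.Properties.CommutativeSemigroup (CommutativeMonoid.commutativeSemigroup +-0-commutativeMonoid)
    using (x∙yz≈y∙xz)

  Σℚ : List ℚ → ℚ
  Σℚ = foldr _+_ 0ℚ

  toℚᵘ-/ : ∀ i d → toℚᵘ (i / suc d) ℚᵘ.≃ mkℚᵘ i d
  toℚᵘ-/ i d = toℚᵘ-fromℚᵘ (mkℚᵘ i d)

  +[1+m]/2≡+m/2+½ : ∀ m → + suc m / 2 ≡ + m / 2 + ½
  +[1+m]/2≡+m/2+½ m = toℚᵘ-injective (begin
    toℚᵘ (+ suc m / 2)                     ≈⟨ toℚᵘ-/ (+ suc m) 1 ⟩
    mkℚᵘ (+ suc m) 1                        ≈⟨ *≡* (numerators (+ m)) ⟩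
    mkℚᵘ (+ m) 1 ℚᵘ.+ mkℚᵘ (+ 1) 1          ≈⟨ ℚᵘP.+-cong (toℚᵘ-/ (+ m) 1) (toℚᵘ-/ (+ 1) 1) ⟨
    toℚᵘ (+ m / 2) ℚᵘ.+ toℚᵘ ½              ≈⟨ toℚᵘ-homo-+ (+ m / 2) ½ ⟨
    toℚᵘ (+ m / 2 + ½)                      ∎)
    where
      open ℚᵘP.≃-Reasoning
      numerators : ∀ x → (+ 1 ℤ.+ x) ℤ.* (+ 2 ℤ.* + 2) ≡ (x ℤ.* + 2 ℤ.+ + 1 ℤ.* + 2) ℤ.* + 2
      numerators = ℤ-Solver.solve-∀

  1/-antitone : ∀ {m k} → m ℕ.≤ k → + 1 / suc k ≤ + 1 / suc m
  1/-antitone {m} {k} m≤k = toℚᵘ-cancel-≤ (begin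
    toℚᵘ (+ 1 / suc k) ≃⟨ toℚᵘ-/ (+ 1) k ⟩
    mkℚᵘ (+ 1) k       ≤⟨ *≤* (ℤ.+≤+ (ℕP.*-monoʳ-≤ 1 (s≤s m≤k))) ⟩
    mkℚᵘ (+ 1) m       ≃⟨ toℚᵘ-/ (+ 1) m ⟨
    toℚᵘ (+ 1 / suc m) ∎)
    where open ℚᵘP.≤-Reasoning

  module _ {A : Set} (r : A → ℚ) where

    Σ-excess : ∀ xs → (1ℚ - + length xs / 2) + Σℚ (map r xs) ≡ 1ℚ + Σℚ (map (λ x → r x - ½) xs)
    Σ-excess []       = refl
    Σ-excess (x ∷ xs) = begin
      (1ℚ - + suc (length xs) / 2) + (r x + Σℚ (map r xs))
        ≡⟨ cong (λ h → (1ℚ - h) + (r x + Σℚ (map r xs))) (+[1+m]/2≡+m/2+½ (length xs)) ⟩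
      (1ℚ - (+ length xs / 2 + ½)) + (r x + Σℚ (map r xs))
        ≡⟨ regroup 1ℚ (+ length xs / 2) (r x) (Σℚ (map r xs)) ⟩
      (r x - ½) + ((1ℚ - + length xs / 2) + Σℚ (map r xs))
        ≡⟨ cong (λ S → (r x - ½) + S) (Σ-excess xs) ⟩
      (r x - ½) + (1ℚ + Σℚ (map (λ x → r x - ½) xs))
        ≡⟨ x∙yz≈y∙xz (r x - ½) 1ℚ (Σℚ (map (λ x → r x - ½) xs)) ⟩
      1ℚ + Σℚ (map (λ x → r x - ½) (x ∷ xs)) ∎
      where
        open ≡-Reasoning
        open +-*-Solver
        regroup : ∀ u h y S → (u - (h + ½)) + (y + S) ≡ (y - ½) + ((u - h) + S)
        regroup = solve 4 (λ u h y S → (u :- (h :+ con ½)) :+ (y :+ S) := (y :- con ½) :+ ((u :- h) :+ S)) refl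

  module _ {A : Set} (P : A → Bool) (u : A → ℚ) {a b : ℚ} (b≤0 : b ≤ 0ℚ)
           (u≤a : ∀ x → T (P x) → u x ≤ a) (u≤b : ∀ x → u x ≤ b) where

    private
      drop : ∀ x {S B} → S ≤ B → u x + S ≤ B
      drop x {S} {B} S≤B = begin
        u x + S  ≤⟨ +-mono-≤ (≤-trans (u≤b x) b≤0) S≤B ⟩
        0ℚ + B   ≡⟨ +-identityˡ B ⟩
        B        ∎
        where open ≤-Reasoning

    Σ-≤-counts : ∀ xs {i j} → i ℕ.≤ count P xs → j ℕ.≤ count (not ∘ P) xs →
                 Σℚ (map u xs) ≤ i ×ₙ a + j ×ₙ b
    Σ-≤-counts []       z≤n z≤n = ≤-refl
    Σ-≤-counts (x ∷ xs) i≤ j≤ with P x in eq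
    Σ-≤-counts (x ∷ xs) {zero}  _       j≤ | true = drop x (Σ-≤-counts xs z≤n j≤)
    Σ-≤-counts (x ∷ xs) {suc i} (s≤s i≤) j≤ | true = begin
      u x + Σℚ (map u xs)   ≤⟨ +-mono-≤ (u≤a x (subst T (sym eq) _)) (Σ-≤-counts xs i≤ j≤) ⟩
      a + (i ×ₙ a + _)      ≡⟨ +-assoc a (i ×ₙ a) _ ⟨
      (a + i ×ₙ a) + _      ∎
      where open ≤-Reasoning
    Σ-≤-counts (x ∷ xs) {j = zero}  i≤ _        | false = drop x (Σ-≤-counts xs i≤ z≤n)
    Σ-≤-counts (x ∷ xs) {i} {suc j} i≤ (s≤s j≤) | false = begin
      u x + Σℚ (map u xs)          ≤⟨ +-mono-≤ (u≤b x) (Σ-≤-counts xs i≤ j≤) ⟩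
      b + (i ×ₙ a + j ×ₙ b)        ≡⟨ x∙yz≈y∙xz b (i ×ₙ a) (j ×ₙ b) ⟩
      i ×ₙ a + (b + j ×ₙ b)        ∎
      where open ≤-Reasoning

module SimpleMap {n : ℕ} (M : Map n) (simple : Simple M) (deg≥2 : ∀ d → 2 ℕ.≤ Map.deg M d) where

  open Map M
  open import Data.Nat
  open import Data.Nat.Properties

  private
    module V = Cycles σ
    module F = Cycles φ

  σ-injective : Injective _≡_ _≡_ σ
  σ-injective {x} {y} σx≡σy = trans (sym (σ⁻σ x)) (trans (cong σ⁻ σx≡σy) (σ⁻σ y))

  α-injective : Injective _≡_ _≡_ α
  α-injective {x} {y} αx≡αy = trans (sym (α-invol x)) (trans (cong α αx≡αy) (α-invol y))

  φ-injective : Injective _≡_ _≡_ φ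
  φ-injective = α-injective ∘ σ-injective

  private
    no-loop : ∀ d → ¬ SameVertex d (α d)
    no-loop = proj₁ simple

    no-parallel-edges : ∀ d d′ → SameVertex d d′ → SameVertex (α d) (α d′) → d ≡ d′
    no-parallel-edges = proj₂ simple

  σ-no-fixpoint : ∀ d → σ d ≢ d
  σ-no-fixpoint d = V.iter-period-minimal d (s≤s z≤n) (deg≥2 d)

  SameVertex-φ : ∀ {x z} → SameVertex x (φ z) → SameVertex x (α z)
  SameVertex-φ {z = z} x↝φz = V.↝-trans x↝φz (V.↝-step⁻ σ-injective (α z))

  -- The edges of x and of α (φ x) would be parallel, so x ≡ α (φ x), i.e. σ (α x) ≡ α x.
  α∘φ-leaves-vertex : ∀ x → ¬ SameVertex x (α (φ x))
  α∘φ-leaves-vertex x x↝αz = σ-no-fixpoint (α x) (sym αx≡z)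
    where
      z = φ x
      x≡αz : x ≡ α z
      x≡αz = no-parallel-edges x (α z) x↝αz (subst (SameVertex (α x)) (sym (α-invol z)) (V.↝-step (α x)))
      αx≡z : α x ≡ z
      αx≡z = trans (cong α x≡αz) (α-invol z)

  φ-return≥3 : ∀ {x y} j → SameVertex x y → iter φ (suc j) x ≡ y → 3 ≤ suc j
  φ-return≥3 {x} 0 x↝y refl = contradiction (SameVertex-φ x↝y) (no-loop x)
  φ-return≥3 {x} 1 x↝y refl = contradiction (SameVertex-φ x↝y) (α∘φ-leaves-vertex x)
  φ-return≥3 (suc (suc j)) _ _ = s≤s (s≤s (s≤s z≤n))

  faceSize≥3 : ∀ c → 3 ≤ faceSize c
  faceSize≥3 c = φ-return≥3 (search φ c n 0) (0 , refl) (F.iter-period φ-injective c)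

  φ-walk≥3 : ∀ {j x y} → SameVertex x y → x ≢ y → iter φ j x ≡ y → 3 ≤ j
  φ-walk≥3 {zero}  _   x≢y x≡y = contradiction x≡y x≢y
  φ-walk≥3 {suc j} x↝y _   fʲ⁺¹x≡y = φ-return≥3 j x↝y fʲ⁺¹x≡y

  φ-walk-to-α≥4 : ∀ {j x} → iter φ j x ≡ α x → 4 ≤ j
  φ-walk-to-α≥4 {zero}  {x} x≡αx = contradiction (sym x≡αx) (α-nofix x)
  φ-walk-to-α≥4 {suc j} {x} fʲ⁺¹x≡αx =
    s≤s (φ-walk≥3 (V.↝-step⁻ σ-injective (α x)) (σ-no-fixpoint (α x)) (trans (F.iter-comm j 1 x) fʲ⁺¹x≡αx))

  φ-walk-to-σ≥5 : ∀ {j x} → iter φ j x ≡ σ x → 5 ≤ j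
  φ-walk-to-σ≥5 {zero}  {x} x≡σx = contradiction (sym x≡σx) (σ-no-fixpoint x)
  φ-walk-to-σ≥5 {suc j} {x} fʲ⁺¹x≡σx = s≤s (φ-walk-to-α≥4 (trans (sym (α-invol (iter φ j x))) (cong α αfʲx≡x)))
    where
      αfʲx≡x : α (iter φ j x) ≡ x
      αfʲx≡x = σ-injective fʲ⁺¹x≡σx

  record Revisit (v s : Fin n) : Set where
    field
      c₁ c₂         : Fin n
      c₁≢c₂         : c₁ ≢ c₂
      around-vertex : V.Arcs (deg v) c₁ c₂
      around-face   : F.Arcs (faceSize s) c₁ c₂

    c₁↝c₂ : SameVertex c₁ c₂
    c₁↝c₂ = V.Arcs.len₁ around-vertex , V.Arcs.iter-len₁ around-vertex

    c₂↝c₁ : SameVertex c₂ c₁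
    c₂↝c₁ = V.Arcs.len₂ around-vertex , V.Arcs.iter-len₂ around-vertex

  revisit : ∀ {v s} → 2 ≤ mult v s → Revisit v s
  revisit {v} {s} twice
    with i , j , i<j , j<deg , hit₁ , hit₂ ←
      two-hits (inOrbit φ s) (λ k → iter σ k v) (deg v)
        (subst (λ cs → 2 ≤ count (inOrbit φ s) cs) (map-upTo (λ k → iter σ k v) (deg v)) twice)
    = record
      { c₁ = iter σ i v ; c₂ = iter σ j v ; c₁≢c₂ = c₁≢c₂
      ; around-vertex = V.arcs σ-injective i<j j<deg
      ; around-face = F.arcs-inOrbit φ-injective hit₁ hit₂ c₁≢c₂
      }
    where c₁≢c₂ = V.iter-≢-below-period σ-injective i<j j<deg

  module _ {v s} (r : Revisit v s) where
    open Revisit r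
    open F.Arcs around-face

    private
      3≤len₁ : 3 ≤ len₁
      3≤len₁ = φ-walk≥3 c₁↝c₂ c₁≢c₂ iter-len₁

      3≤len₂ : 3 ≤ len₂
      3≤len₂ = φ-walk≥3 c₂↝c₁ (≢-sym c₁≢c₂) iter-len₂

    revisit⇒6≤faceSize : 6 ≤ faceSize s
    revisit⇒6≤faceSize = F.arcs-length around-face 3≤len₁ 3≤len₂

    revisit⇒8≤faceSize : deg v ≡ 3 → 8 ≤ faceSize s
    revisit⇒8≤faceSize deg≡3 with V.arcs₃-adjacent (subst (λ p → V.Arcs p c₁ c₂) deg≡3 around-vertex) c₁≢c₂
    ... | inj₁ c₂≡σc₁ = F.arcs-length around-face (φ-walk-to-σ≥5 (trans iter-len₁ c₂≡σc₁)) 3≤len₂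
    ... | inj₂ c₁≡σc₂ = F.arcs-length around-face 3≤len₁ (φ-walk-to-σ≥5 (trans iter-len₂ c₁≡σc₂))

module Curvature {n : ℕ} (M : Map n) (simple : Simple M) (deg≥2 : ∀ d → 2 ℕ.≤ Map.deg M d) where

  open Map M
  open SimpleMap M simple deg≥2
  open import Data.Integer using (+_)
  import Data.Nat.Properties as ℕP
  open import Data.Rational using (1ℚ; ½; -_; _+_; _-_; _/_; _≤_; _≤?_; +-0-rawMonoid)
  open import Data.Rational.Properties using (+-monoˡ-≤; +-monoʳ-≤; module ≤-Reasoning)
  open import Algebra.Definitions.RawMonoid +-0-rawMonoid using () renaming (_×_ to _×ₙ_)
  open import Relation.Nullary.Decidable using (toWitness)

  private
    module F = Cycles φ

  sumℚ≡Σℚ : ∀ qs → sumℚ qs ≡ Σℚ qs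
  sumℚ≡Σℚ []       = refl
  sumℚ≡Σℚ (q ∷ qs) = cong (λ S → q + S) (sumℚ≡Σℚ qs)

  length-corners : ∀ d → length (corners d) ≡ deg d
  length-corners d = trans (length-map (λ i → iter σ i d) (upTo (deg d))) (length-upTo (deg d))

  K≡1+Σexcess : ∀ d → K d ≡ 1ℚ + Σℚ (map (λ c → recip c - ½) (corners d))
  K≡1+Σexcess d = begin
    (1ℚ - + deg d / 2) + sumℚ (map recip (corners d))
      ≡⟨ cong₂ (λ m S → (1ℚ - + m / 2) + S) (sym (length-corners d)) (sumℚ≡Σℚ (map recip (corners d))) ⟩
    (1ℚ - + length (corners d) / 2) + Σℚ (map recip (corners d))
      ≡⟨ Σ-excess recip (corners d) ⟩
    1ℚ + Σℚ (map (λ c → recip c - ½) (corners d)) ∎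
    where open ≡-Reasoning

  off-face-corners : ∀ {v s i j} → mult v s ≡ i → i ℕ.+ j ℕ.≤ deg v →
                     j ℕ.≤ count (not ∘ inOrbit φ s) (corners v)
  off-face-corners {v} {s} {i} {j} mult≡i i+j≤deg =
    ℕP.+-cancelˡ-≤ i j _ (ℕP.≤-trans i+j≤deg (ℕP.≤-reflexive deg≡i+off))
    where
      open ≡-Reasoning
      deg≡i+off : deg v ≡ i ℕ.+ count (not ∘ inOrbit φ s) (corners v)
      deg≡i+off = begin
        deg v                                              ≡⟨ length-corners v ⟨
        length (corners v)                                 ≡⟨ count+count-not (inOrbit φ s) (corners v) ⟨
        mult v s ℕ.+ count (not ∘ inOrbit φ s) (corners v) ≡⟨ cong (ℕ._+ _) mult≡i ⟩
        i ℕ.+ count (not ∘ inOrbit φ s) (corners v)        ∎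

  curvature-bound : ∀ {v s i j k} → mult v s ≡ i → suc k ℕ.≤ faceSize s → i ℕ.+ j ℕ.≤ deg v →
                    K v ≤ 1ℚ + (i ×ₙ (+ 1 / suc k - ½) + j ×ₙ (+ 1 / 3 - ½))
  curvature-bound {v} {s} {i} {j} {k} mult≡i k<|s| i+j≤deg = begin
    K v                                                  ≡⟨ K≡1+Σexcess v ⟩
    1ℚ + Σℚ (map excess (corners v))                     ≤⟨ +-monoʳ-≤ 1ℚ Σexcess≤ ⟩
    1ℚ + (i ×ₙ (+ 1 / suc k - ½) + j ×ₙ (+ 1 / 3 - ½))   ∎
    where
      open ≤-Reasoning
      excess : Fin n → ℚ
      excess c = recip c - ½

      on-face : ∀ c → T (inOrbit φ s c) → excess c ≤ + 1 / suc k - ½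
      on-face c hit with a , _ , refl ← F.inOrbit-sound hit =
        +-monoˡ-≤ (- ½) (1/-antitone (ℕP.≤-pred k<|c|))
        where
          k<|c| : suc k ℕ.≤ faceSize (iter φ a s)
          k<|c| = subst (suc k ℕ.≤_) (sym (F.period-iter φ-injective a s)) k<|s|

      anywhere : ∀ c → excess c ≤ + 1 / 3 - ½
      anywhere c = +-monoˡ-≤ (- ½) (1/-antitone (ℕP.≤-pred (faceSize≥3 c)))

      Σexcess≤ : Σℚ (map excess (corners v)) ≤ i ×ₙ (+ 1 / suc k - ½) + j ×ₙ (+ 1 / 3 - ½)
      Σexcess≤ = Σ-≤-counts (inOrbit φ s) excess (toWitness {a? = _ ≤? _} _) on-face anywhere (corners v)
                   (ℕP.≤-reflexive (sym mult≡i)) (off-face-corners {s = s} mult≡i i+j≤deg)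

open import Data.Nat using (_+_; _≤_; _≤?_)
open import Data.Nat.Properties using (≤-trans; ≤-reflexive; n≤1+n; m≤n⇒m<n∨m≡n; ≰⇒>)
open import Data.Integer using (+_)
open import Data.Rational as ℚ using (1ℚ; +-0-rawMonoid)
import Data.Rational.Properties as ℚP
open import Algebra.Definitions.RawMonoid +-0-rawMonoid using () renaming (_×_ to _×ₙ_)
open import Relation.Nullary.Decidable using (toWitness)

corollary2p3 : (n : ℕ) (M : Map n) → PlanarPCC M → (v s : Fin n) →
    Map.mult M v s ≡ 2 → 7 ≤ Map.faceSize M s × Map.faceSize M s ≤ 11
corollary2p3 n M (_ , simple , _ , K>0 , deg≥3 , _) v s twice = 7≤|s| , |s|≤11
  where
    open Map M
    deg≥2 : ∀ d → 2 ≤ deg d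
    deg≥2 d = ≤-trans (n≤1+n 2) (deg≥3 d)
    open SimpleMap M simple deg≥2
    open Curvature M simple deg≥2

    revisits : Revisit v s
    revisits = revisit (≤-reflexive (sym twice))

    nonpositive-bound-absurd : ∀ {k j} → suc k ≤ faceSize s → 2 + j ≤ deg v →
      1ℚ ℚ.+ (2 ×ₙ (+ 1 ℚ./ suc k ℚ.- ℚ.½) ℚ.+ j ×ₙ (+ 1 ℚ./ 3 ℚ.- ℚ.½)) ℚ.≤ ℚ.0ℚ → ⊥
    nonpositive-bound-absurd k<|s| 2+j≤deg bound≤0 =
      ℚP.<-irrefl refl (ℚP.<-≤-trans (K>0 v) (ℚP.≤-trans (curvature-bound twice k<|s| 2+j≤deg) bound≤0))

    7≤|s| : 7 ≤ faceSize s
    7≤|s| with m≤n⇒m<n∨m≡n (deg≥3 v)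
    ... | inj₁ 3<deg = contradiction (toWitness {a? = _ ℚ.≤? _} _)
                         (nonpositive-bound-absurd (revisit⇒6≤faceSize revisits) 3<deg)
    ... | inj₂ 3≡deg = ≤-trans (n≤1+n 7) (revisit⇒8≤faceSize revisits (sym 3≡deg))

    |s|≤11 : faceSize s ≤ 11
    |s|≤11 with faceSize s ≤? 11
    ... | yes |s|≤11 = |s|≤11
    ... | no  |s|≰11 = contradiction (toWitness {a? = _ ℚ.≤? _} _)
                         (nonpositive-bound-absurd (≰⇒> |s|≰11) (deg≥3 v))
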